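{- Let $R$ be a $\Sigma$-semiring and $M$ an $R$-module. Then $M$ has a countable dual basis if and only if there exist an $R$-module $V$ having a countable orthogonal dual basis and $R$-linear maps $\varphi:M\to V$, $e:V\to M$ with $e\circ\varphi=\mathrm{id}_M$. In other words, the full subcategory $\mathbf{DBMod}_R$ of $\mathbf{Mod}_R$ is equivalent to the idempotent completion (Karoubi envelope) of $\mathbf{Vec}_R$.
   Context: A $\Sigma$-monoid is a set with $0$ and a partial countable sum satisfying the unit law, invariance under reindexing and removal/insertion of zeros, and infinite associativity ($\sum_ix_i\simeq\sum_j\sum_kx_{\sigma(j,k)}$). A $\Sigma$-semiring adds a total commutative associative unital multiplication with $0x=0$ and $(\sum x_i)(\sum y_j)$ defined implying $\sum_{i,j}x_iy_j$ defined and equal. An $R$-module is a $\Sigma$-monoid with a total action satisfying $(rr')x=r(r'x)$, $1x=x$, $0x=r0=0$ and the analogous distributivity; $R$-linear maps preserve $0$, action and sums (if $\sum x_i$ is defined then $\sum f(x_i)$ is defined and equals $f(\sum x_i)$). $\mathbf{Mod}_R$ is the category of $R$-modules. A countable dual basis of $M$ is a countable family $(e_i,\varphi_i)_{i\in I}$, $e_i\in|M|$, $\varphi_i:M\to R$ $R$-linear, with $x=\sum_i\varphi_i(x)\cdot e_i$ for all $x\in|M|$; it is orthogonal if moreover $\varphi_i(e_j)=\delta_{i,j}$. $\mathbf{DBMod}_R$ and $\mathbf{Vec}_R$ are the full subcategories of $\mathbf{Mod}_R$ of modules having a countable dual basis, resp. a countable orthogonal dual basis. -}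

module Defs where

open import Data.Nat using (ℕ)
open import Data.Unit using (⊤; tt)
open import Data.Product using (Σ; _×_; _,_; proj₁; proj₂)
open import Function using (_∘_)
open import Function.Bundles using (_↔_; Inverse)
open import Relation.Binary.PropositionalEquality using (_≡_; _≢_; refl)
open import Relation.Binary.Structures using (IsEquivalence)

-- Countable index sets: a type with an injection into ℕ
-- (covers finite and countably infinite index sets).

record CSet : Set₁ where
  field
    Idx     : Set
    enc     : Idx → ℕ
    enc-inj : ∀ {i j} → enc i ≡ enc j → i ≡ j

open CSet public

⊤C : CSet
⊤C = record { Idx = ⊤ ; enc = λ _ → 0 ; enc-inj = λ _ → refl }

-- Σ-monoids.  A set (setoid) with 0 and a partial countable sum,
-- given as a relation  HasSum I x s  ("∑_{i∈I} x_i is defined and equals s").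

record SigmaMonoid : Set₁ where
  field
    Carrier       : Set
    _≈_           : Carrier → Carrier → Set
    isEquivalence : IsEquivalence _≈_
    0#            : Carrier
    HasSum        : (I : CSet) → (Idx I → Carrier) → Carrier → Set
    sum-cong       : ∀ {I} {x y : Idx I → Carrier} {s t} →
                     (∀ i → x i ≈ y i) → s ≈ t → HasSum I x s → HasSum I y t
    sum-functional : ∀ {I} {x : Idx I → Carrier} {s t} →
                     HasSum I x s → HasSum I x t → s ≈ t
    sum-unit       : ∀ x → HasSum ⊤C (λ _ → x) x
    sum-reindex    : ∀ {I J} (σ : Idx J ↔ Idx I) (x : Idx I → Carrier) {s} →
                     (HasSum I x s → HasSum J (x ∘ Inverse.to σ) s) ×
                     (HasSum J (x ∘ Inverse.to σ) s → HasSum I x s)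
    sum-zeros      : ∀ {I J} (ι : Idx J → Idx I) →
                     (∀ {a b} → ι a ≡ ι b → a ≡ b) →
                     (x : Idx I → Carrier) →
                     (∀ i → (∀ j → ι j ≢ i) → x i ≈ 0#) → ∀ {s} →
                     (HasSum I x s → HasSum J (x ∘ ι) s) ×
                     (HasSum J (x ∘ ι) s → HasSum I x s)
    sum-assoc      : ∀ {I J} (K : Idx J → CSet)
                     (σ : Σ (Idx J) (λ j → Idx (K j)) ↔ Idx I)
                     (x : Idx I → Carrier) {s} →
                     (HasSum I x s →
                       Σ (Idx J → Carrier) λ y →
                         (∀ j → HasSum (K j) (λ k → x (Inverse.to σ (j , k))) (y j))
                         × HasSum J y s) ×
                     (Σ (Idx J → Carrier) (λ y →
                         (∀ j → HasSum (K j) (λ k → x (Inverse.to σ (j , k))) (y j))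
                         × HasSum J y s) →
                       HasSum I x s)

record SigmaSemiring : Set₁ where
  field
    monoid : SigmaMonoid
  open SigmaMonoid monoid public
  field
    _*_         : Carrier → Carrier → Carrier
    1#          : Carrier
    *-cong      : ∀ {x x′ y y′} → x ≈ x′ → y ≈ y′ → (x * y) ≈ (x′ * y′)
    *-comm      : ∀ x y → (x * y) ≈ (y * x)
    *-assoc     : ∀ x y z → ((x * y) * z) ≈ (x * (y * z))
    *-identityˡ : ∀ x → (1# * x) ≈ x
    *-zeroˡ     : ∀ x → (0# * x) ≈ 0#
    -- (∑ x_i)(∑ y_j) defined ⇒ ∑_{i,j} x_i y_j defined and equal
    -- (the product index set I×J is presented by any K with K ≅ I × J)
    *-distrib   : ∀ {I J} (K : CSet) (τ : Idx K ↔ (Idx I × Idx J))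
                  {x : Idx I → Carrier} {y : Idx J → Carrier} {s t} →
                  HasSum I x s → HasSum J y t →
                  HasSum K (λ k → x (proj₁ (Inverse.to τ k)) * y (proj₂ (Inverse.to τ k)))
                         (s * t)

record Module (R : SigmaSemiring) : Set₁ where
  private module R = SigmaSemiring R
  field
    monoid : SigmaMonoid
  open SigmaMonoid monoid public
  field
    _·_      : R.Carrier → Carrier → Carrier
    ·-cong   : ∀ {r r′ x x′} → r R.≈ r′ → x ≈ x′ → (r · x) ≈ (r′ · x′)
    ·-assoc  : ∀ r r′ x → ((r R.* r′) · x) ≈ (r · (r′ · x))
    ·-identity : ∀ x → (R.1# · x) ≈ x
    ·-zeroˡ  : ∀ x → (R.0# · x) ≈ 0#
    ·-zeroʳ  : ∀ r → (r · 0#) ≈ 0#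
    ·-distrib : ∀ {I J} (K : CSet) (τ : Idx K ↔ (Idx I × Idx J))
                {r : Idx I → R.Carrier} {x : Idx J → Carrier} {s t} →
                R.HasSum I r s → HasSum J x t →
                HasSum K (λ k → r (proj₁ (Inverse.to τ k)) · x (proj₂ (Inverse.to τ k)))
                       (s · t)

regular : (R : SigmaSemiring) → Module R
regular R = record
  { monoid     = monoid
  ; _·_        = _*_
  ; ·-cong     = *-cong
  ; ·-assoc    = *-assoc
  ; ·-identity = *-identityˡ
  ; ·-zeroˡ    = *-zeroˡ
  ; ·-zeroʳ    = λ r → trans (*-comm r 0#) (*-zeroˡ r)
  ; ·-distrib  = *-distrib
  }
  where
    open SigmaSemiring R
    open IsEquivalence isEquivalence

record Linear {R : SigmaSemiring} (M N : Module R) : Set₁ where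
  private
    module M = Module M
    module N = Module N
  field
    fun      : M.Carrier → N.Carrier
    cong     : ∀ {x y} → x M.≈ y → fun x N.≈ fun y
    pres-0   : fun M.0# N.≈ N.0#
    pres-·   : ∀ r x → fun (r M.· x) N.≈ (r N.· fun x)
    pres-sum : ∀ {I} {x : Idx I → M.Carrier} {s} →
               M.HasSum I x s → N.HasSum I (fun ∘ x) (fun s)

open Linear public using (fun)

record DualBasis {R : SigmaSemiring} (M : Module R) : Set₁ where
  private module M = Module M
  field
    I      : CSet
    e      : Idx I → M.Carrier
    φ      : Idx I → Linear M (regular R)
    expand : ∀ x → M.HasSum I (λ i → fun (φ i) x M.· e i) x

record OrthDualBasis {R : SigmaSemiring} (M : Module R) : Set₁ where
  private module R = SigmaSemiring R
  field
    basis : DualBasis M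
  open DualBasis basis public
  field
    orth-eq  : ∀ i → fun (φ i) (e i) R.≈ R.1#
    orth-neq : ∀ i j → i ≢ j → fun (φ i) (e j) R.≈ R.0#

-- If (eᵢ, φᵢ) is a dual basis of M, let V be the module of coefficient families
-- (rᵢ) for which ∑ rᵢ·eᵢ is defined, with coordinatewise sums and action.  The
-- unit families δᵢ together with the coordinate projections form an orthogonal
-- dual basis of V, evaluation r ↦ ∑ rᵢ·eᵢ is linear (by exchanging the two sums),
-- and x ↦ (φᵢ x) is a linear section of it.  Conversely, if M is a retract of V
-- via φ and e, then (e eᵢ, φᵢ ∘ φ) is a dual basis of M for any dual basis of V.

module Submission where

open import Defs
open import Data.Empty using (⊥; ⊥-elim)
open import Data.Nat as ℕ using (ℕ; zero; suc; _+_; _≤_; _<_; z≤n; s≤s)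
open import Data.Nat.Properties
  using (≤-refl; +-mono-≤; +-monoʳ-≤; +-monoʳ-<; n<1+n; m≤m+n; m≤n+m; <-cmp; <-irrefl;
         +-cancelˡ-≡; +-cancelʳ-≡; module ≤-Reasoning)
open import Data.Product using (Σ; _×_; _,_; proj₁; proj₂)
open import Data.Product.Algebra using (×-comm)
open import Data.Unit using (tt)
open import Function using (_∘_)
open import Function.Bundles using (_⇔_; mk⇔; _↔_; Inverse; mk↔ₛ′)
open import Function.Properties.Inverse using (↔-refl)
open import Relation.Binary.Definitions using (DecidableEquality; tri<; tri≈; tri>)
open import Relation.Binary.PropositionalEquality
  using (_≡_; _≢_; refl; sym; trans; cong; cong₂)
open import Relation.Binary.Structures using (IsEquivalence)
open import Relation.Nullary using (yes; no)
open import Relation.Nullary.Decidable using (map′)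

triangle : ℕ → ℕ
triangle zero    = 0
triangle (suc n) = triangle n + suc n

triangle-mono-≤ : ∀ {m n} → m ≤ n → triangle m ≤ triangle n
triangle-mono-≤ {n = zero}        z≤n       = ≤-refl
triangle-mono-≤ {zero}  {suc n}   _         = z≤n
triangle-mono-≤ {suc m} {suc n}   (s≤s m≤n) = +-mono-≤ (triangle-mono-≤ m≤n) (s≤s m≤n)

triangle+≤<triangle+ : ∀ {m n b b′} → b ≤ m → m < n → triangle m + b < triangle n + b′
triangle+≤<triangle+ {m} {n} {b} {b′} b≤m m<n = begin-strict
  triangle m + b       ≤⟨ +-monoʳ-≤ (triangle m) b≤m ⟩
  triangle m + m       <⟨ +-monoʳ-< (triangle m) (n<1+n m) ⟩
  triangle (suc m)     ≤⟨ triangle-mono-≤ m<n ⟩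
  triangle n           ≤⟨ m≤m+n (triangle n) b′ ⟩
  triangle n + b′      ∎
  where open ≤-Reasoning

cantor : ℕ → ℕ → ℕ
cantor a b = triangle (a + b) + b

cantor-injective : ∀ {a b a′ b′} → cantor a b ≡ cantor a′ b′ → a ≡ a′ × b ≡ b′
cantor-injective {a} {b} {a′} {b′} eq with <-cmp (a + b) (a′ + b′)
... | tri< d<d′ _ _ = ⊥-elim (<-irrefl eq (triangle+≤<triangle+ (m≤n+m b a) d<d′))
... | tri> _ _ d>d′ = ⊥-elim (<-irrefl (sym eq) (triangle+≤<triangle+ (m≤n+m b′ a′) d>d′))
... | tri≈ _ d≡d′ _ = a≡a′ , b≡b′
  where
  b≡b′ : b ≡ b′
  b≡b′ = +-cancelˡ-≡ (triangle (a + b)) b b′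
           (trans eq (cong (λ d → triangle d + b′) (sym d≡d′)))
  a≡a′ : a ≡ a′
  a≡a′ = +-cancelʳ-≡ b a a′ (trans d≡d′ (cong (a′ +_) (sym b≡b′)))

_×ᶜ_ : CSet → CSet → CSet
A ×ᶜ B = record
  { Idx     = Idx A × Idx B
  ; enc     = λ (a , b) → cantor (enc A a) (enc B b)
  ; enc-inj = λ eq → let (a≡a′ , b≡b′) = cantor-injective eq
                     in cong₂ _,_ (enc-inj A a≡a′) (enc-inj B b≡b′)
  }

∅ᶜ : CSet
∅ᶜ = record { Idx = ⊥ ; enc = λ () ; enc-inj = λ {i} → ⊥-elim i }

Idx-≟ : (I : CSet) → DecidableEquality (Idx I)
Idx-≟ I i j = map′ (enc-inj I) (cong (enc I)) (enc I i ℕ.≟ enc I j)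

module SigmaMonoidProperties (S : SigmaMonoid) where
  open SigmaMonoid S
  open IsEquivalence isEquivalence using () renaming (refl to ≈-refl)

  sum-∅ : (x : ⊥ → Carrier) → HasSum ∅ᶜ x 0#
  sum-∅ x = sum-cong (λ ()) ≈-refl
    (proj₁ (sum-zeros {⊤C} {∅ᶜ} (λ ()) (λ {a} → ⊥-elim a) (λ _ → 0#) (λ _ _ → ≈-refl))
           (sum-unit 0#))

  sum-0# : ∀ I → HasSum I (λ _ → 0#) 0#
  sum-0# I = proj₂ (sum-zeros {I} {∅ᶜ} (λ ()) (λ {a} → ⊥-elim a) (λ _ → 0#) (λ _ _ → ≈-refl))
                   (sum-∅ _)

  sum-single : ∀ I (k : Idx I) (x : Idx I → Carrier) →
               (∀ i → i ≢ k → x i ≈ 0#) → HasSum I x (x k)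
  sum-single I k x x≈0 =
    proj₂ (sum-zeros {I} {⊤C} (λ _ → k) (λ _ → refl) x
                     (λ i i∉k → x≈0 i (λ i≡k → i∉k tt (sym i≡k))))
          (sum-unit (x k))

  sum-swap : ∀ {A B} (x : Idx A → Idx B → Carrier)
             {r : Idx A → Carrier} {c : Idx B → Carrier} {s} →
             (∀ a → HasSum B (x a) (r a)) → (∀ b → HasSum A (λ a → x a b) (c b)) →
             HasSum A r s → HasSum B c s
  sum-swap {A} {B} x {r} rows cols Σr =
    sum-cong (λ b → sum-functional (inner b) (cols b)) ≈-refl outer
    where
    Σ-A×B : HasSum (A ×ᶜ B) (λ (a , b) → x a b) _
    Σ-A×B = proj₂ (sum-assoc {A ×ᶜ B} {A} (λ _ → B) ↔-refl (λ (a , b) → x a b)) (r , rows , Σr)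
    Σ-B×A : HasSum (B ×ᶜ A) (λ (b , a) → x a b) _
    Σ-B×A = proj₁ (sum-reindex {A ×ᶜ B} {B ×ᶜ A} (×-comm (Idx B) (Idx A)) (λ (a , b) → x a b)) Σ-A×B
    regrouped = proj₁ (sum-assoc {B ×ᶜ A} {B} (λ _ → A) ↔-refl (λ (b , a) → x a b)) Σ-B×A
    inner = proj₁ (proj₂ regrouped)
    outer = proj₂ (proj₂ regrouped)

module SigmaSemiringProperties (R : SigmaSemiring) where
  open SigmaSemiring R
  open IsEquivalence isEquivalence using () renaming (trans to ≈-trans)

  *-identityʳ : ∀ x → (x * 1#) ≈ x
  *-identityʳ x = ≈-trans (*-comm x 1#) (*-identityˡ x)

  *-zeroʳ : ∀ x → (x * 0#) ≈ 0#
  *-zeroʳ x = ≈-trans (*-comm x 0#) (*-zeroˡ x)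

module ModuleProperties {R : SigmaSemiring} (M : Module R) where
  private module R = SigmaSemiring R
  open Module M

  sum-·ʳ : ∀ {I} {r : Idx I → R.Carrier} {s} (x : Carrier) →
           R.HasSum I r s → HasSum I (λ i → r i · x) (s · x)
  sum-·ʳ {I} x Σr = ·-distrib I (mk↔ₛ′ (_, tt) proj₁ (λ _ → refl) (λ _ → refl)) Σr (sum-unit x)

  sum-·ˡ : ∀ {I} {x : Idx I → Carrier} {s} (r : R.Carrier) →
           HasSum I x s → HasSum I (λ i → r · x i) (r · s)
  sum-·ˡ {I} r Σx = ·-distrib I (mk↔ₛ′ (tt ,_) proj₂ (λ _ → refl) (λ _ → refl)) (R.sum-unit r) Σx

_∘ₗ_ : ∀ {R} {M N P : Module R} → Linear N P → Linear M N → Linear M P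
_∘ₗ_ {P = P} g f = record
  { fun      = fun g ∘ fun f
  ; cong     = G.cong ∘ F.cong
  ; pres-0   = P.trans (G.cong F.pres-0) G.pres-0
  ; pres-·   = λ r x → P.trans (G.cong (F.pres-· r x)) (G.pres-· r (fun f x))
  ; pres-sum = G.pres-sum ∘ F.pres-sum
  }
  where
  module F = Linear f
  module G = Linear g
  module P = IsEquivalence (Module.isEquivalence P)

module Expansions {R : SigmaSemiring} (M : Module R) {I : CSet} (e : Idx I → Module.Carrier M) where
  private
    module R  = SigmaSemiring R
    module M  = Module M
    module R≈ = IsEquivalence R.isEquivalence
    module M≈ = IsEquivalence M.isEquivalence
    open SigmaSemiringProperties R
    open ModuleProperties M
    module RΣ = SigmaMonoidProperties R.monoid
    module MΣ = SigmaMonoidProperties M.monoid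

  record Expansion : Set where
    field
      coeff   : Idx I → R.Carrier
      value   : M.Carrier
      expands : M.HasSum I (λ i → coeff i M.· e i) value
  open Expansion

  -- Values need not be compared: they are determined by the coefficients.
  _≈ₑ_ : Expansion → Expansion → Set
  u ≈ₑ v = ∀ i → coeff u i R.≈ coeff v i

  HasSumₑ : (J : CSet) → (Idx J → Expansion) → Expansion → Set
  HasSumₑ J x s = ∀ i → R.HasSum J (λ j → coeff (x j) i) (coeff s i)

  evaluate-sum : ∀ {J} {x : Idx J → Expansion} {c : Idx I → R.Carrier} {m} →
                 (∀ i → R.HasSum J (λ j → coeff (x j) i) (c i)) →
                 M.HasSum I (λ i → c i M.· e i) m → M.HasSum J (value ∘ x) m
  evaluate-sum {x = x} Σcoeff =
    MΣ.sum-swap (λ i j → coeff (x j) i M.· e i) (λ i → sum-·ʳ (e i) (Σcoeff i)) (expands ∘ x)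

  expand-sum : ∀ {J} {x : Idx J → Expansion} {c : Idx I → R.Carrier} {m} →
               (∀ i → R.HasSum J (λ j → coeff (x j) i) (c i)) →
               M.HasSum J (value ∘ x) m → M.HasSum I (λ i → c i M.· e i) m
  expand-sum {x = x} Σcoeff =
    MΣ.sum-swap (λ j i → coeff (x j) i M.· e i) (expands ∘ x) (λ i → sum-·ʳ (e i) (Σcoeff i))

  -- The regrouped coefficient families are expansions because the values can be
  -- regrouped in M in the same way.
  sumₑ-regroup : ∀ {I₀ J₀} (K : Idx J₀ → CSet) (σ : Σ (Idx J₀) (Idx ∘ K) ↔ Idx I₀)
                 (x : Idx I₀ → Expansion) {s} → HasSumₑ I₀ x s →
                 Σ (Idx J₀ → Expansion) λ y →
                   (∀ j → HasSumₑ (K j) (λ k → x (Inverse.to σ (j , k))) (y j)) × HasSumₑ J₀ y s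
  sumₑ-regroup {I₀} {J₀} K σ x {s} Σx = y , (λ j i → inner i j) , outer
    where
    regroupR = λ i → proj₁ (R.sum-assoc K σ (λ p → coeff (x p) i)) (Σx i)
    inner = λ i → proj₁ (proj₂ (regroupR i))
    outer = λ i → proj₂ (proj₂ (regroupR i))
    regroupM = proj₁ (M.sum-assoc {I₀} {J₀} K σ (value ∘ x)) (evaluate-sum {x = x} Σx (expands s))
    y : _ → Expansion
    y j = record
      { coeff   = λ i → proj₁ (regroupR i) j
      ; value   = proj₁ regroupM j
      ; expands = expand-sum {x = λ k → x (Inverse.to σ (j , k))}
                    (λ i → inner i j) (proj₁ (proj₂ regroupM) j)
      }

  sumₑ-ungroup : ∀ {I₀ J₀} (K : Idx J₀ → CSet) (σ : Σ (Idx J₀) (Idx ∘ K) ↔ Idx I₀)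
                 (x : Idx I₀ → Expansion) {s} →
                 (Σ (Idx J₀ → Expansion) λ y →
                   (∀ j → HasSumₑ (K j) (λ k → x (Inverse.to σ (j , k))) (y j)) × HasSumₑ J₀ y s) →
                 HasSumₑ I₀ x s
  sumₑ-ungroup K σ x (y , inner , outer) i =
    proj₂ (R.sum-assoc K σ (λ p → coeff (x p) i)) ((λ j → coeff (y j) i) , (λ j → inner j i) , outer i)

  0ₑ : Expansion
  0ₑ = record
    { coeff   = λ _ → R.0#
    ; value   = M.0#
    ; expands = M.sum-cong (λ i → M≈.sym (M.·-zeroˡ (e i))) M≈.refl (MΣ.sum-0# I)
    }

  _·ₑ_ : R.Carrier → Expansion → Expansion
  r ·ₑ v = record
    { coeff   = λ i → r R.* coeff v i
    ; value   = r M.· value v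
    ; expands = M.sum-cong (λ i → M≈.sym (M.·-assoc r (coeff v i) (e i))) M≈.refl
                  (sum-·ˡ r (expands v))
    }

  expansionMonoid : SigmaMonoid
  expansionMonoid = record
    { Carrier        = Expansion
    ; _≈_            = _≈ₑ_
    ; isEquivalence  = record
      { refl  = λ _ → R≈.refl
      ; sym   = λ u≈v i → R≈.sym (u≈v i)
      ; trans = λ u≈v v≈w i → R≈.trans (u≈v i) (v≈w i)
      }
    ; 0#             = 0ₑ
    ; HasSum         = HasSumₑ
    ; sum-cong       = λ x≈y s≈t Σx i → R.sum-cong (λ j → x≈y j i) (s≈t i) (Σx i)
    ; sum-functional = λ Σs Σt i → R.sum-functional (Σs i) (Σt i)
    ; sum-unit       = λ x i → R.sum-unit (coeff x i)
    ; sum-reindex    = λ σ x →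
        (λ Σx i → proj₁ (R.sum-reindex σ (λ j → coeff (x j) i)) (Σx i)) ,
        (λ Σx i → proj₂ (R.sum-reindex σ (λ j → coeff (x j) i)) (Σx i))
    ; sum-zeros      = λ ι ι-inj x x≈0 →
        (λ Σx i → proj₁ (R.sum-zeros ι ι-inj (λ j → coeff (x j) i) (λ j j∉ι → x≈0 j j∉ι i)) (Σx i)) ,
        (λ Σx i → proj₂ (R.sum-zeros ι ι-inj (λ j → coeff (x j) i) (λ j j∉ι → x≈0 j j∉ι i)) (Σx i))
    ; sum-assoc      = λ K σ x {s} → sumₑ-regroup K σ x {s} , sumₑ-ungroup K σ x {s}
    }

  expansions : Module R
  expansions = record
    { monoid     = expansionMonoid
    ; _·_        = _·ₑ_
    ; ·-cong     = λ r≈r′ x≈x′ i → R.*-cong r≈r′ (x≈x′ i)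
    ; ·-assoc    = λ r r′ x i → R.*-assoc r r′ (coeff x i)
    ; ·-identity = λ x i → R.*-identityˡ (coeff x i)
    ; ·-zeroˡ    = λ x i → R.*-zeroˡ (coeff x i)
    ; ·-zeroʳ    = λ r _ → *-zeroʳ r
    ; ·-distrib  = λ K τ Σr Σx i → R.*-distrib K τ Σr (Σx i)
    }

  evaluate : Linear expansions M
  evaluate = record
    { fun      = value
    ; cong     = λ {u} {v} u≈v → M.sum-functional (expands u)
        (M.sum-cong (λ i → M.·-cong (R≈.sym (u≈v i)) M≈.refl) M≈.refl (expands v))
    ; pres-0   = M≈.refl
    ; pres-·   = λ _ _ → M≈.refl
    ; pres-sum = λ {_} {x} {s} Σx → evaluate-sum {x = x} Σx (expands s)
    }

  δ : Idx I → Idx I → R.Carrier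
  δ i k with Idx-≟ I i k
  ... | yes _ = R.1#
  ... | no  _ = R.0#

  δ-diag : ∀ i → δ i i R.≈ R.1#
  δ-diag i with Idx-≟ I i i
  ... | yes _  = R≈.refl
  ... | no i≢i = ⊥-elim (i≢i refl)

  δ-off : ∀ i k → i ≢ k → δ i k R.≈ R.0#
  δ-off i k i≢k with Idx-≟ I i k
  ... | yes i≡k = ⊥-elim (i≢k i≡k)
  ... | no _    = R≈.refl

  unit : Idx I → Expansion
  unit i = record
    { coeff   = δ i
    ; value   = e i
    ; expands = M.sum-cong (λ _ → M≈.refl)
        (M≈.trans (M.·-cong (δ-diag i) M≈.refl) (M.·-identity (e i)))
        (MΣ.sum-single I i (λ k → δ i k M.· e k)
          (λ k k≢i → M≈.trans (M.·-cong (δ-off i k (k≢i ∘ sym)) M≈.refl) (M.·-zeroˡ (e k))))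
    }

  coordinate : Idx I → Linear expansions (regular R)
  coordinate i = record
    { cong     = λ u≈v → u≈v i
    ; pres-0   = R≈.refl
    ; pres-·   = λ _ _ → R≈.refl
    ; pres-sum = λ Σx → Σx i
    }

  standardBasis : OrthDualBasis expansions
  standardBasis = record
    { basis    = record
      { I      = I
      ; e      = unit
      ; φ      = coordinate
      ; expand = λ v k → R.sum-cong (λ _ → R≈.refl)
          (R≈.trans (R.*-cong R≈.refl (δ-diag k)) (*-identityʳ _))
          (RΣ.sum-single I k (λ i → coeff v i R.* δ i k)
            (λ i i≢k → R≈.trans (R.*-cong R≈.refl (δ-off i k i≢k)) (*-zeroʳ _)))
      }
    ; orth-eq  = δ-diag
    ; orth-neq = λ i j i≢j → δ-off j i (i≢j ∘ sym)
    }

module _ {R : SigmaSemiring} {M : Module R} where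
  private module M = Module M

  coordinates : (D : DualBasis M) → Linear M (Expansions.expansions M (DualBasis.e D))
  coordinates D = record
    { fun      = λ x → record { coeff = λ i → fun (φ i) x ; value = x ; expands = expand x }
    ; cong     = λ x≈y i → Linear.cong (φ i) x≈y
    ; pres-0   = λ i → Linear.pres-0 (φ i)
    ; pres-·   = λ r x i → Linear.pres-· (φ i) r x
    ; pres-sum = λ Σx i → Linear.pres-sum (φ i) Σx
    }
    where open DualBasis D

  retract-of-orthDualBasis : DualBasis M →
    Σ (Module R) λ V → OrthDualBasis V ×
      (Σ (Linear M V) λ φ → Σ (Linear V M) λ e → ∀ x → fun e (fun φ x) M.≈ x)
  retract-of-orthDualBasis D =
    expansions , standardBasis , coordinates D , evaluate , λ _ → IsEquivalence.refl M.isEquivalence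
    where open Expansions M (DualBasis.e D)

  dualBasis-of-retract : ∀ {V : Module R} (φ : Linear M V) (e : Linear V M) →
                         (∀ x → fun e (fun φ x) M.≈ x) → DualBasis V → DualBasis M
  dualBasis-of-retract φ e e∘φ≈id B = record
    { I      = Bᵥ.I
    ; e      = fun e ∘ Bᵥ.e
    ; φ      = λ i → Bᵥ.φ i ∘ₗ φ
    ; expand = λ x → M.sum-cong (λ i → Linear.pres-· e _ (Bᵥ.e i)) (e∘φ≈id x)
                       (Linear.pres-sum e (Bᵥ.expand (fun φ x)))
    }
    where
    module Bᵥ = DualBasis B

proposition5p12 : (R : SigmaSemiring) (M : Module R) →
    DualBasis M ⇔
      (Σ (Module R) λ V → OrthDualBasis V ×
        (Σ (Linear M V) λ φ → Σ (Linear V M) λ e →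
          ∀ x → Module._≈_ M (fun e (fun φ x)) x))
proposition5p12 R M = mk⇔ retract-of-orthDualBasis
  (λ (V , O , φ , e , e∘φ≈id) → dualBasis-of-retract φ e e∘φ≈id (OrthDualBasis.basis O))
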